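{- Let $\mathcal{O}$ be the maximal $\mathbb{Z}_p$-order in the quaternion division algebra over $\mathbb{Q}_p$, and for $N\ge0$ let $\mathcal{O}_N=\mathbb{Z}_p+p^N\mathcal{O}$. For an order $\mathcal{O}'\subseteq\mathcal{O}$ of finite index, let $\mathrm{Ind}(\mathcal{O}')=\log_p([\mathcal{O}:\mathcal{O}'])$ and $\mathrm{App}(\mathcal{O}')=\min\{N:\mathcal{O}'\supseteq\mathcal{O}_N\}$. Then $\mathrm{App}(\mathcal{O}')\le\mathrm{Ind}(\mathcal{O}')$. -}

module Defs where

open import Data.Nat as ℕ using (ℕ; zero; suc)
open import Data.Integer using (ℤ; +_; _+_; _*_; -_; _-_)
open import Data.Integer.Divisibility.Signed using (_∣_; ∣m∣n⇒∣m+n; ∣m⇒∣-m; ∣n⇒∣m*n; ∣m⇒∣m*n; divides)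
open import Data.Integer.Properties using (+-inverseʳ; +-inverseˡ; *-zeroˡ; +-assoc; +-identityˡ; neg-distrib-+; neg-distribˡ-*; neg-distribʳ-*; *-distribˡ-+; *-distribʳ-+; +-commutativeSemigroup)
open import Algebra.Properties.CommutativeSemigroup +-commutativeSemigroup using (interchange)
open import Data.Fin using (Fin)
open import Data.Product using (Σ; ∃; _×_; _,_)
open import Relation.Binary.PropositionalEquality using (_≡_; refl; sym; trans; subst; cong; cong₂; module ≡-Reasoning)
open import Relation.Nullary using (¬_)

-- p-adic integers ℤ_p, constructively: coherent sequences of integers
-- x = (x₀, x₁, …) with x_{n+1} ≡ x_n (mod p^n); x_n approximates x mod p^n.

pow : ℕ → ℕ → ℤ
pow p n = + (p ℕ.^ n)

record ℤₚ (p : ℕ) : Set where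
  constructor mkℤₚ
  field
    seq : ℕ → ℤ
    coh : ∀ n → pow p n ∣ (seq (suc n) - seq n)
open ℤₚ public

module _ {p : ℕ} where
  infix 4 _≈ₚ_
  infixl 6 _+ₚ_
  infixl 7 _*ₚ_

  _≈ₚ_ : ℤₚ p → ℤₚ p → Set
  x ≈ₚ y = ∀ n → pow p n ∣ (seq x n - seq y n)

  private
    ∣0 : ∀ {k} z → k ∣ (z - z)
    ∣0 {k} z = divides (+ 0) (trans (+-inverseʳ z) (sym (*-zeroˡ k)))
    eq+ : ∀ a b c d → (a + b) - (c + d) ≡ (a - c) + (b - d)
    eq+ a b c d = trans (cong (λ u → (a + b) + u) (neg-distrib-+ c d)) (interchange a b (- c) (- d))
    eq- : ∀ a c → (- a) - (- c) ≡ - (a - c)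
    eq- a c = sym (neg-distrib-+ a (- c))
    eq* : ∀ a b c d → (a * b) - (c * d) ≡ a * (b - d) + (a - c) * d
    eq* a b c d = sym (begin
      a * (b - d) + (a - c) * d
        ≡⟨ cong₂ _+_ (*-distribˡ-+ a b (- d)) (*-distribʳ-+ d a (- c)) ⟩
      (a * b + a * (- d)) + (a * d + (- c) * d)
        ≡⟨ cong₂ (λ u v → (a * b + u) + (a * d + v)) (sym (neg-distribʳ-* a d)) (sym (neg-distribˡ-* c d)) ⟩
      (a * b + - (a * d)) + (a * d + - (c * d))
        ≡⟨ +-assoc (a * b) (- (a * d)) (a * d + - (c * d)) ⟩
      a * b + (- (a * d) + (a * d + - (c * d)))
        ≡⟨ cong (λ u → a * b + u) (sym (+-assoc (- (a * d)) (a * d) (- (c * d)))) ⟩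
      a * b + ((- (a * d) + a * d) + - (c * d))
        ≡⟨ cong (λ u → a * b + (u + - (c * d))) (+-inverseˡ (a * d)) ⟩
      a * b + (+ 0 + - (c * d))
        ≡⟨ cong (λ u → a * b + u) (+-identityˡ (- (c * d))) ⟩
      a * b - c * d ∎)
      where open ≡-Reasoning

  -- The ring operations are opaque (to keep terms small); they unfold
  -- to the pointwise operations on the approximating sequences.
  opaque
    fromℤ : ℤ → ℤₚ p
    fromℤ z = mkℤₚ (λ _ → z) (λ n → ∣0 z)

    _+ₚ_ : ℤₚ p → ℤₚ p → ℤₚ p
    x +ₚ y = mkℤₚ (λ n → seq x n + seq y n)
      (λ n → subst (pow p n ∣_) (sym (eq+ (seq x (suc n)) (seq y (suc n)) (seq x n) (seq y n)))
                   (∣m∣n⇒∣m+n (coh x n) (coh y n)))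

    -ₚ_ : ℤₚ p → ℤₚ p
    -ₚ x = mkℤₚ (λ n → - seq x n)
      (λ n → subst (pow p n ∣_) (sym (eq- (seq x (suc n)) (seq x n))) (∣m⇒∣-m (coh x n)))

    _*ₚ_ : ℤₚ p → ℤₚ p → ℤₚ p
    x *ₚ y = mkℤₚ (λ n → seq x n * seq y n)
      (λ n → subst (pow p n ∣_) (sym (eq* (seq x (suc n)) (seq y (suc n)) (seq x n) (seq y n)))
                   (∣m∣n⇒∣m+n (∣n⇒∣m*n (seq x (suc n)) (coh y n)) (∣m⇒∣m*n (seq y n) (coh x n))))

-- Let f = x² + a x + b be irreducible mod p. Then ℤ_{p²} := ℤ_p[ω]
-- (ω² + aω + b = 0) is the ring of integers of the unramified quadratic
-- extension of ℚ_p, with Frobenius ω ↦ ω̄ = -a - ω.  The quaternion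
-- division algebra over ℚ_p is the cyclic algebra ℚ_{p²} ⊕ ℚ_{p²} π
-- with π² = p, π z = z̄ π, and its (unique) maximal ℤ_p-order is
-- 𝒪 = ℤ_{p²} ⊕ ℤ_{p²} π.

IrreducibleModP : ℕ → ℤ → ℤ → Set
IrreducibleModP p a b =
  ¬ (Σ ℤ λ r → Σ ℤ λ s → (+ p ∣ (r + s) - a) × (+ p ∣ (r * s) - b))

module Quaternion (p : ℕ) (a b : ℤ) where

  record ℤₚ² : Set where
    constructor _+ω_
    field
      re : ℤₚ p
      im : ℤₚ p
  open ℤₚ² public

  infix 4 _≈²_
  infixl 6 _+²_
  infixl 7 _*²_
  infix 5 _+ω_
  _≈²_ : ℤₚ² → ℤₚ² → Set
  u ≈² v = (re u ≈ₚ re v) × (im u ≈ₚ im v)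

  _+²_ : ℤₚ² → ℤₚ² → ℤₚ²
  u +² v = (re u +ₚ re v) +ω (im u +ₚ im v)

  -²_ : ℤₚ² → ℤₚ²
  -² u = (-ₚ re u) +ω (-ₚ im u)

  _*²_ : ℤₚ² → ℤₚ² → ℤₚ²
  u *² v =
    (re u *ₚ re v +ₚ (-ₚ (fromℤ b *ₚ (im u *ₚ im v))))
    +ω (re u *ₚ im v +ₚ re v *ₚ im u +ₚ (-ₚ (fromℤ a *ₚ (im u *ₚ im v))))

  -- Frobenius: x + y ω ↦ x + y(-a - ω) = (x - a y) - y ω
  conj : ℤₚ² → ℤₚ²
  conj u = (re u +ₚ (-ₚ (fromℤ a *ₚ im u))) +ω (-ₚ im u)

  zero² one² : ℤₚ²
  zero² = fromℤ (+ 0) +ω fromℤ (+ 0)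
  one²  = fromℤ (+ 1) +ω fromℤ (+ 0)

  record 𝒪 : Set where
    constructor _+π_
    field
      fst : ℤₚ²
      snd : ℤₚ²
  open 𝒪 public

  infix 4 _≈_
  infix 5 _+π_
  infixl 6 _+𝒪_ _-𝒪_
  infixl 7 _*𝒪_ _·_

  _≈_ : 𝒪 → 𝒪 → Set
  x ≈ y = (fst x ≈² fst y) × (snd x ≈² snd y)

  _+𝒪_ : 𝒪 → 𝒪 → 𝒪
  x +𝒪 y = (fst x +² fst y) +π (snd x +² snd y)

  -𝒪_ : 𝒪 → 𝒪
  -𝒪 x = (-² fst x) +π (-² snd x)

  _-𝒪_ : 𝒪 → 𝒪 → 𝒪
  x -𝒪 y = x +𝒪 (-𝒪 y)

  _*𝒪_ : 𝒪 → 𝒪 → 𝒪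
  x *𝒪 y =
    (fst x *² fst y +² (fromℤ (+ p) +ω fromℤ (+ 0)) *² (snd x *² conj (snd y)))
    +π (fst x *² snd y +² snd x *² conj (fst y))

  _·_ : ℤₚ p → 𝒪 → 𝒪
  t · x = ((t +ω fromℤ (+ 0)) *² fst x) +π ((t +ω fromℤ (+ 0)) *² snd x)

  1𝒪 : 𝒪
  1𝒪 = one² +π zero²

  record IsOrder (S : 𝒪 → Set) : Set where
    field
      resp  : ∀ {x y} → x ≈ y → S x → S y
      one∈  : S 1𝒪
      +-closed : ∀ {x y} → S x → S y → S (x +𝒪 y)
      ·-closed : ∀ t {x} → S x → S (t · x)
      *-closed : ∀ {x y} → S x → S y → S (x *𝒪 y)

  -- [𝒪 : S] = m  (index of additive groups): there are m representatives
  -- r₀ … r_{m-1} of 𝒪 / S, covering every coset exactly once.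
  HasIndex : (𝒪 → Set) → ℕ → Set
  HasIndex S m = Σ (Fin m → 𝒪) λ r →
    (∀ x → Σ (Fin m) λ i → S (x -𝒪 r i)) ×
    (∀ i j → S (r i -𝒪 r j) → i ≡ j)

  _∈𝒪_ : 𝒪 → ℕ → Set
  y ∈𝒪 N = Σ (ℤₚ p) λ t → Σ 𝒪 λ x → y ≈ t · 1𝒪 +𝒪 fromℤ (pow p N) · x

  LevelIn : ℕ → (𝒪 → Set) → Set
  LevelIn N S = ∀ y → y ∈𝒪 N → S y

-- Fix x ∈ 𝒪. The set of t ∈ ℤ_p with t·x ∈ S absorbs multiplication by ℤ_p.
-- Two of the p^k + 1 elements 0·x, 1·x, …, p^k·x lie in the same coset of S,
-- so d·x ∈ S for some 0 < d ≤ p^k. Write d = p^v u with p ∤ u: Bézout gives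
-- α u = 1 - q with p ∣ q, and 1 - q is a unit of ℤ_p with inverse the
-- geometric series Σ qⁿ, so p^v·x ∈ S. As p^v ≤ d ≤ p^k, also p^k·x ∈ S,
-- whence ℤ_p + p^k 𝒪 ⊆ S.
module Submission where

open import Defs
open import Data.Nat as ℕ
  using (ℕ; zero; suc; _≤_; _<_; _^_; _∸_; NonZero; >-nonZero; ≢-nonZero; ≢-nonZero⁻¹; nonTrivial⇒n>1)
open import Data.Nat.Properties
  using (*-identityˡ; *-comm; *-assoc; ≤-refl; ≤-trans; <⇒≤; ≮⇒≥; <⇒≱; n<1+n; m<m*n; m≤m*n;
         ^-monoʳ-<; ^-distribˡ-+-*; m∸n+n≡m; m∸n≤m; m<n⇒0<n∸m)
open import Data.Nat.Divisibility using (_∤_; _∣?_; _∣0; divides)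
open import Data.Nat.Primality using (Prime; prime⇒irreducible; prime⇒nonTrivial)
open import Data.Nat.Coprimality using (Coprime; coprime-Bézout)
open import Data.Nat.GCD using (module Bézout)
open import Data.Nat.Induction using (<-wellFounded)
open import Induction.WellFounded using (Acc; acc)
open import Data.Integer using (ℤ; +_; -_; _+_; _*_; _-_; 0ℤ; 1ℤ; -1ℤ)
import Data.Integer as ℤ using (_^_)
open import Data.Integer.Properties
  using (pos-+; pos-*; neg-involutive; -1*i≡-i; *-zeroˡ; +-inverseʳ; m-n≡m⊖n; ⊖-≥)
import Data.Integer.Properties as ℤ using (*-assoc)
import Data.Integer.Divisibility.Signed as ℤ∣
open import Data.Integer.Tactic.RingSolver using (solve-∀)
open import Data.Fin using (Fin; toℕ)
open import Data.Fin.Properties using (pigeonhole; toℕ≤pred[n])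
open import Data.Product using (Σ; ∃₂; _×_; _,_; proj₁; proj₂)
open import Data.Sum using (inj₁; inj₂)
open import Function using (_∘_)
open import Relation.Nullary using (yes; no)
open import Relation.Nullary.Negation using (contradiction)
open import Relation.Binary.PropositionalEquality
  using (_≡_; refl; sym; trans; cong; cong₂; subst; module ≡-Reasoning)

module _ {p : ℕ} (p-prime : Prime p) where

  private
    1<p : 1 < p
    1<p = nonTrivial⇒n>1 p {{prime⇒nonTrivial p-prime}}

  ^-cancelˡ-≤ : ∀ {v k} → p ^ v ≤ p ^ k → v ≤ k
  ^-cancelˡ-≤ p^v≤p^k = ≮⇒≥ (λ k<v → <⇒≱ (^-monoʳ-< p 1<p k<v) p^v≤p^k)

  prime∤⇒coprime : ∀ {n} → p ∤ n → Coprime n p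
  prime∤⇒coprime p∤n {d} (d∣n , d∣p) with prime⇒irreducible p-prime d∣p
  ... | inj₁ d≡1 = d≡1
  ... | inj₂ refl = contradiction d∣n p∤n

  p-free-part : ∀ d .{{_ : NonZero d}} → ∃₂ λ v u → d ≡ p ^ v ℕ.* u × p ∤ u
  p-free-part d = split d (<-wellFounded d)
    where
    split : ∀ d .{{_ : NonZero d}} → Acc _<_ d → ∃₂ λ v u → d ≡ p ^ v ℕ.* u × p ∤ u
    split d (acc rec) with p ∣? d
    ... | no p∤d = 0 , d , sym (*-identityˡ d) , p∤d
    ... | yes (divides zero d≡0) = contradiction d≡0 (≢-nonZero⁻¹ d)
    ... | yes (divides q@(suc _) d≡q*p) with split q (rec (subst (q <_) (sym d≡q*p) (m<m*n q p 1<p)))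
    ... | v , u , q≡p^v*u , p∤u = suc v , u , eq , p∤u
      where
      open ≡-Reasoning
      eq : d ≡ p ^ suc v ℕ.* u
      eq = begin
        d                       ≡⟨ d≡q*p ⟩
        q ℕ.* p                 ≡⟨ cong (ℕ._* p) q≡p^v*u ⟩
        p ^ v ℕ.* u ℕ.* p       ≡⟨ *-comm (p ^ v ℕ.* u) p ⟩
        p ℕ.* (p ^ v ℕ.* u)     ≡⟨ sym (*-assoc p (p ^ v) u) ⟩
        p ^ suc v ℕ.* u         ∎

private
  cast-Bézout : ∀ m n k l → 1 ℕ.+ m ℕ.* n ≡ k ℕ.* l → 1ℤ + + m * + n ≡ + k * + l
  cast-Bézout m n k l eq = begin
    1ℤ + + m * + n     ≡⟨ cong (_+_ 1ℤ) (sym (pos-* m n)) ⟩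
    1ℤ + + (m ℕ.* n)   ≡⟨ sym (pos-+ 1 (m ℕ.* n)) ⟩
    + (1 ℕ.+ m ℕ.* n)  ≡⟨ cong +_ eq ⟩
    + (k ℕ.* l)        ≡⟨ pos-* k l ⟩
    + k * + l          ∎
    where open ≡-Reasoning

coprime⇒invertible-mod : ∀ {u p} → Coprime u p → ∃₂ λ α q → + p ℤ∣.∣ q × α * + u ≡ 1ℤ - q
coprime⇒invertible-mod {u} {p} coprime with coprime-Bézout coprime
... | Bézout.+- x y eq =
  + x , - (+ y * + p) , ℤ∣.∣m⇒∣-m (ℤ∣.∣n⇒∣m*n (+ y) ℤ∣.∣-refl) ,
  trans (sym (cast-Bézout y p x u eq)) (cong (_+_ 1ℤ) (sym (neg-involutive (+ y * + p))))
... | Bézout.-+ x y eq =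
  - + x , + y * + p , ℤ∣.∣n⇒∣m*n (+ y) ℤ∣.∣-refl ,
  trans (-x*u≡1-[1+x*u] (+ x) (+ u)) (cong (_-_ 1ℤ) (cast-Bézout x u y p eq))
  where
  -x*u≡1-[1+x*u] : ∀ x u → - x * u ≡ 1ℤ - (1ℤ + x * u)
  -x*u≡1-[1+x*u] = solve-∀

module _ {p : ℕ} where

  ≈ₚ-pointwise : {x y : ℤₚ p} → (∀ n → seq x n ≡ seq y n) → x ≈ₚ y
  ≈ₚ-pointwise {x} {y} x≡y n = ℤ∣.divides 0ℤ (begin
    seq x n - seq y n  ≡⟨ cong (_- seq y n) (x≡y n) ⟩
    seq y n - seq y n  ≡⟨ +-inverseʳ (seq y n) ⟩
    0ℤ                 ≡⟨ sym (*-zeroˡ (pow p n)) ⟩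
    0ℤ * pow p n       ∎)
    where open ≡-Reasoning

  ≈ₚ-sym : {x y : ℤₚ p} → x ≈ₚ y → y ≈ₚ x
  ≈ₚ-sym {x} {y} x≈y n = subst (pow p n ℤ∣.∣_) (-[i-j]≡j-i (seq x n) (seq y n)) (ℤ∣.∣m⇒∣-m (x≈y n))
    where
    -[i-j]≡j-i : ∀ i j → - (i - j) ≡ j - i
    -[i-j]≡j-i = solve-∀

  opaque
    unfolding fromℤ _*ₚ_

    seq-fromℤ : ∀ z n → seq (fromℤ {p} z) n ≡ z
    seq-fromℤ z n = refl

    seq-*ₚ : ∀ (x y : ℤₚ p) n → seq (x *ₚ y) n ≡ seq x n * seq y n
    seq-*ₚ x y n = refl

  fromℤ-*ₚ : ∀ w z → fromℤ w *ₚ fromℤ z ≈ₚ fromℤ {p} (w * z)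
  fromℤ-*ₚ w z = ≈ₚ-pointwise {fromℤ w *ₚ fromℤ z} {fromℤ (w * z)} λ n →
    trans (seq-*ₚ (fromℤ w) (fromℤ z) n)
          (trans (cong₂ _*_ (seq-fromℤ w n) (seq-fromℤ z n)) (sym (seq-fromℤ (w * z) n)))

geometric : ℤ → ℕ → ℤ
geometric q zero    = 0ℤ
geometric q (suc n) = geometric q n + q ℤ.^ n

geometric-telescopes : ∀ q n → geometric q n * (1ℤ - q) ≡ 1ℤ - q ℤ.^ n
geometric-telescopes q zero    = refl
geometric-telescopes q (suc n) = begin
  (geometric q n + q ℤ.^ n) * (1ℤ - q)         ≡⟨ distrib (geometric q n) (q ℤ.^ n) q ⟩
  geometric q n * (1ℤ - q) + q ℤ.^ n - q * q ℤ.^ n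
      ≡⟨ cong (λ g → g + q ℤ.^ n - q * q ℤ.^ n) (geometric-telescopes q n) ⟩
  1ℤ - q ℤ.^ n + q ℤ.^ n - q * q ℤ.^ n          ≡⟨ cancel (q ℤ.^ n) (q * q ℤ.^ n) ⟩
  1ℤ - q * q ℤ.^ n                              ∎
  where
  open ≡-Reasoning
  distrib : ∀ g r q → (g + r) * (1ℤ - q) ≡ g * (1ℤ - q) + r - q * r
  distrib = solve-∀
  cancel : ∀ r s → 1ℤ - r + r - s ≡ 1ℤ - s
  cancel = solve-∀

module _ {p : ℕ} {q : ℤ} (p∣q : + p ℤ∣.∣ q) where

  pow∣^ : ∀ n → pow p n ℤ∣.∣ q ℤ.^ n
  pow∣^ zero    = ℤ∣.∣-refl
  pow∣^ (suc n) = subst (ℤ∣._∣ q * q ℤ.^ n) (sym (pos-* p (p ^ n)))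
    (ℤ∣.∣-trans (ℤ∣.*-monoʳ-∣ (+ p) (pow∣^ n)) (ℤ∣.*-monoˡ-∣ (q ℤ.^ n) p∣q))

  geometricₚ : ℤₚ p
  geometricₚ = mkℤₚ (geometric q) λ n →
    subst (pow p n ℤ∣.∣_) (sym (g+r-g≡r (geometric q n) (q ℤ.^ n))) (pow∣^ n)
    where
    g+r-g≡r : ∀ g r → g + r - g ≡ r
    g+r-g≡r = solve-∀

  geometricₚ-inverse : ∀ z → geometricₚ *ₚ fromℤ (z * (1ℤ - q)) ≈ₚ fromℤ z
  geometricₚ-inverse z n = subst (pow p n ℤ∣.∣_) (sym eq) (ℤ∣.∣n⇒∣m*n (- z) (pow∣^ n))
    where
    open ≡-Reasoning
    g = geometric q n
    eq : seq (geometricₚ *ₚ fromℤ (z * (1ℤ - q))) n - seq (fromℤ z) n ≡ - z * q ℤ.^ n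
    eq = begin
      seq (geometricₚ *ₚ fromℤ (z * (1ℤ - q))) n - seq (fromℤ z) n
        ≡⟨ cong₂ _-_ (trans (seq-*ₚ geometricₚ _ n) (cong (g *_) (seq-fromℤ _ n))) (seq-fromℤ z n) ⟩
      g * (z * (1ℤ - q)) - z   ≡⟨ regroup g z q ⟩
      z * (g * (1ℤ - q)) - z   ≡⟨ cong (λ t → z * t - z) (geometric-telescopes q n) ⟩
      z * (1ℤ - q ℤ.^ n) - z   ≡⟨ expand z (q ℤ.^ n) ⟩
      - z * q ℤ.^ n            ∎
      where
      regroup : ∀ g z q → g * (z * (1ℤ - q)) - z ≡ z * (g * (1ℤ - q)) - z
      regroup = solve-∀
      expand : ∀ z r → z * (1ℤ - r) - z ≡ - z * r
      expand = solve-∀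

record IsAbsorbing {p : ℕ} (I : ℤₚ p → Set) : Set where
  field
    resp     : ∀ {s t} → s ≈ₚ t → I s → I t
    *-closed : ∀ c {t} → I t → I (c *ₚ t)

module _ {p : ℕ} {I : ℤₚ p → Set} (isAbsorbing : IsAbsorbing I) where
  open IsAbsorbing isAbsorbing

  fromℤ-*-closed : ∀ w {z} → I (fromℤ z) → I (fromℤ (w * z))
  fromℤ-*-closed w {z} =
    resp {fromℤ w *ₚ fromℤ z} {fromℤ (w * z)} (fromℤ-*ₚ w z) ∘ *-closed (fromℤ w)

  unit-cancel : ∀ {q z} → + p ℤ∣.∣ q → I (fromℤ (z * (1ℤ - q))) → I (fromℤ z)
  unit-cancel {z = z} p∣q = resp {_} {fromℤ z} (geometricₚ-inverse p∣q z) ∘ *-closed (geometricₚ p∣q)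

  pow∈-mono : ∀ {v k} → v ≤ k → I (fromℤ (pow p v)) → I (fromℤ (pow p k))
  pow∈-mono {v} {k} v≤k = subst (I ∘ fromℤ) eq ∘ fromℤ-*-closed (pow p (k ∸ v))
    where
    open ≡-Reasoning
    eq : pow p (k ∸ v) * pow p v ≡ pow p k
    eq = begin
      pow p (k ∸ v) * pow p v   ≡⟨ sym (pos-* (p ^ (k ∸ v)) (p ^ v)) ⟩
      + (p ^ (k ∸ v) ℕ.* p ^ v) ≡⟨ cong +_ (sym (^-distribˡ-+-* p (k ∸ v) v)) ⟩
      + (p ^ (k ∸ v ℕ.+ v))     ≡⟨ cong (λ e → + (p ^ e)) (m∸n+n≡m v≤k) ⟩
      pow p k                   ∎

  module _ (p-prime : Prime p) where

    p-part∈ : ∀ {v u} → p ∤ u → I (fromℤ (+ (p ^ v ℕ.* u))) → I (fromℤ (pow p v))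
    p-part∈ {v} {u} p∤u d∈I with coprime⇒invertible-mod (prime∤⇒coprime p-prime p∤u)
    ... | α , q , p∣q , αu≡1-q = unit-cancel p∣q (subst (I ∘ fromℤ) eq (fromℤ-*-closed α d∈I))
      where
      open ≡-Reasoning
      eq : α * + (p ^ v ℕ.* u) ≡ pow p v * (1ℤ - q)
      eq = begin
        α * + (p ^ v ℕ.* u)      ≡⟨ cong (α *_) (pos-* (p ^ v) u) ⟩
        α * (pow p v * + u)      ≡⟨ swap α (pow p v) (+ u) ⟩
        pow p v * (α * + u)      ≡⟨ cong (pow p v *_) αu≡1-q ⟩
        pow p v * (1ℤ - q)       ∎
        where
        swap : ∀ a b c → a * (b * c) ≡ b * (a * c)
        swap = solve-∀

    bounded∈⇒pow∈ : ∀ {k} d .{{_ : NonZero d}} → d ≤ p ^ k → I (fromℤ (+ d)) → I (fromℤ (pow p k))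
    bounded∈⇒pow∈ {k} d d≤p^k d∈I with p-free-part p-prime d
    ... | v , u , d≡p^v*u , p∤u =
      pow∈-mono {v} {k} (^-cancelˡ-≤ p-prime p^v≤p^k)
                        (p-part∈ {v} p∤u (subst (I ∘ fromℤ ∘ +_) d≡p^v*u d∈I))
      where
      instance
        u≢0 : NonZero u
        u≢0 = ≢-nonZero λ { refl → p∤u (p ∣0) }
      p^v≤p^k : p ^ v ≤ p ^ k
      p^v≤p^k = ≤-trans (m≤m*n (p ^ v) u) (subst (_≤ p ^ k) d≡p^v*u d≤p^k)

module QuaternionOrder (p : ℕ) (a b : ℤ) where
  open Quaternion p a b

  data Coord : Set where
    re₁ im₁ re₂ im₂ : Coord

  coord : Coord → 𝒪 → ℤₚ p
  coord re₁ = re ∘ fst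
  coord im₁ = im ∘ fst
  coord re₂ = re ∘ snd
  coord im₂ = im ∘ snd

  ≈-coordwise : ∀ {x y} → (∀ c → coord c x ≈ₚ coord c y) → x ≈ y
  ≈-coordwise x≈y = (x≈y re₁ , x≈y im₁) , (x≈y re₂ , x≈y im₂)

  ≈-pointwise : ∀ {x y} → (∀ c n → seq (coord c x) n ≡ seq (coord c y) n) → x ≈ y
  ≈-pointwise {x} {y} x≡y = ≈-coordwise λ c → ≈ₚ-pointwise {x = coord c x} {coord c y} (x≡y c)

  ≈-sym : ∀ {x y} → x ≈ y → y ≈ x
  ≈-sym {x} {y} ((e₁ , e₂) , (e₃ , e₄)) =
    (≈ₚ-sym {x = re (fst x)} {re (fst y)} e₁ , ≈ₚ-sym {x = im (fst x)} {im (fst y)} e₂) ,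
    (≈ₚ-sym {x = re (snd x)} {re (snd y)} e₃ , ≈ₚ-sym {x = im (snd x)} {im (snd y)} e₄)

  opaque
    unfolding fromℤ _+ₚ_ -ₚ_ _*ₚ_

    coord-neg : ∀ c x n → seq (coord c (-𝒪 x)) n ≡ - seq (coord c x) n
    coord-neg re₁ x n = refl
    coord-neg im₁ x n = refl
    coord-neg re₂ x n = refl
    coord-neg im₂ x n = refl

    coord-sub : ∀ c x y n → seq (coord c (x -𝒪 y)) n ≡ seq (coord c x) n - seq (coord c y) n
    coord-sub re₁ x y n = refl
    coord-sub im₁ x y n = refl
    coord-sub re₂ x y n = refl
    coord-sub im₂ x y n = refl

    private
      re-scale : ∀ b t x y → t * x + - (b * (0ℤ * y)) ≡ t * x
      re-scale = solve-∀
      im-scale : ∀ a t x y → t * y + x * 0ℤ + - (a * (0ℤ * y)) ≡ t * y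
      im-scale = solve-∀

    coord-· : ∀ c t x n → seq (coord c (t · x)) n ≡ seq t n * seq (coord c x) n
    coord-· re₁ t x n = re-scale b (seq t n) (seq (re (fst x)) n) (seq (im (fst x)) n)
    coord-· im₁ t x n = im-scale a (seq t n) (seq (re (fst x)) n) (seq (im (fst x)) n)
    coord-· re₂ t x n = re-scale b (seq t n) (seq (re (snd x)) n) (seq (im (snd x)) n)
    coord-· im₂ t x n = im-scale a (seq t n) (seq (re (snd x)) n) (seq (im (snd x)) n)

  coord-·-fromℤ : ∀ c z x n → seq (coord c (fromℤ z · x)) n ≡ z * seq (coord c x) n
  coord-·-fromℤ c z x n = trans (coord-· c (fromℤ z) x n) (cong (_* seq (coord c x) n) (seq-fromℤ z n))

  -1·≈neg : ∀ x → fromℤ -1ℤ · x ≈ -𝒪 x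
  -1·≈neg x = ≈-pointwise λ c n →
    trans (coord-·-fromℤ c -1ℤ x n) (trans (-1*i≡-i _) (sym (coord-neg c x n)))

  [u-r]-[v-r]≈u-v : ∀ u v r → (u -𝒪 r) -𝒪 (v -𝒪 r) ≈ u -𝒪 v
  [u-r]-[v-r]≈u-v u v r = ≈-pointwise λ c n → begin
    seq (coord c ((u -𝒪 r) -𝒪 (v -𝒪 r))) n
      ≡⟨ trans (coord-sub c _ _ n) (cong₂ _-_ (coord-sub c u r n) (coord-sub c v r n)) ⟩
    (U c n - R c n) - (V c n - R c n)   ≡⟨ cancel (U c n) (V c n) (R c n) ⟩
    U c n - V c n                       ≡⟨ sym (coord-sub c u v n) ⟩
    seq (coord c (u -𝒪 v)) n            ∎
    where
    open ≡-Reasoning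
    U V R : Coord → ℕ → ℤ
    U c = seq (coord c u)
    V c = seq (coord c v)
    R c = seq (coord c r)
    cancel : ∀ u v r → (u - r) - (v - r) ≡ u - v
    cancel = solve-∀

  fromℤ-·-sub : ∀ z w x → fromℤ z · x -𝒪 fromℤ w · x ≈ fromℤ (z - w) · x
  fromℤ-·-sub z w x = ≈-pointwise λ c n → begin
    seq (coord c (fromℤ z · x -𝒪 fromℤ w · x)) n
      ≡⟨ trans (coord-sub c _ _ n) (cong₂ _-_ (coord-·-fromℤ c z x n) (coord-·-fromℤ c w x n)) ⟩
    z * seq (coord c x) n - w * seq (coord c x) n  ≡⟨ distrib z w (seq (coord c x) n) ⟩
    (z - w) * seq (coord c x) n                    ≡⟨ sym (coord-·-fromℤ c (z - w) x n) ⟩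
    seq (coord c (fromℤ (z - w) · x)) n            ∎
    where
    open ≡-Reasoning
    distrib : ∀ z w y → z * y - w * y ≡ (z - w) * y
    distrib = solve-∀

  ·-congʳ : ∀ {s t} x → s ≈ₚ t → s · x ≈ t · x
  ·-congʳ {s} {t} x s≈t = ≈-coordwise λ c n →
    subst (pow p n ℤ∣.∣_) (sym (eq c n)) (ℤ∣.∣n⇒∣m*n (seq (coord c x) n) (s≈t n))
    where
    open ≡-Reasoning
    eq : ∀ c n → seq (coord c (s · x)) n - seq (coord c (t · x)) n
               ≡ seq (coord c x) n * (seq s n - seq t n)
    eq c n = begin
      seq (coord c (s · x)) n - seq (coord c (t · x)) n
        ≡⟨ cong₂ _-_ (coord-· c s x n) (coord-· c t x n) ⟩
      seq s n * seq (coord c x) n - seq t n * seq (coord c x) n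
        ≡⟨ factor (seq s n) (seq t n) (seq (coord c x) n) ⟩
      seq (coord c x) n * (seq s n - seq t n) ∎
      where
      factor : ∀ s t y → s * y - t * y ≡ y * (s - t)
      factor = solve-∀

  ·-assoc : ∀ c t x → c · (t · x) ≈ (c *ₚ t) · x
  ·-assoc c t x = ≈-pointwise λ i n → begin
    seq (coord i (c · (t · x))) n
      ≡⟨ trans (coord-· i c (t · x) n) (cong (seq c n *_) (coord-· i t x n)) ⟩
    seq c n * (seq t n * seq (coord i x) n)    ≡⟨ sym (ℤ.*-assoc (seq c n) (seq t n) _) ⟩
    seq c n * seq t n * seq (coord i x) n      ≡⟨ cong (_* seq (coord i x) n) (sym (seq-*ₚ c t n)) ⟩
    seq (c *ₚ t) n * seq (coord i x) n         ≡⟨ sym (coord-· i (c *ₚ t) x n) ⟩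
    seq (coord i ((c *ₚ t) · x)) n             ∎
    where open ≡-Reasoning

  module _ {S : 𝒪 → Set} (isOrder : IsOrder S) where
    open IsOrder isOrder

    -𝒪-closed : ∀ {x y} → S x → S y → S (x -𝒪 y)
    -𝒪-closed {y = y} x∈S y∈S = +-closed x∈S (resp (-1·≈neg y) (·-closed (fromℤ -1ℤ) y∈S))

    annihilator-isAbsorbing : ∀ x → IsAbsorbing (λ t → S (t · x))
    annihilator-isAbsorbing x = record
      { resp     = λ s≈t → resp (·-congʳ x s≈t)
      ; *-closed = λ c {t} → resp (·-assoc c t x) ∘ ·-closed c
      }

    index-pigeonhole : ∀ {m} → HasIndex S m → (f : Fin (suc m) → 𝒪) →
                       ∃₂ λ i j → toℕ i < toℕ j × S (f j -𝒪 f i)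
    index-pigeonhole {m} (r , cover , _) f with pigeonhole (n<1+n m) (proj₁ ∘ cover ∘ f)
    ... | i , j , i<j , same-coset = i , j , i<j ,
      resp ([u-r]-[v-r]≈u-v (f j) (f i) (r rep))
           (-𝒪-closed (proj₂ (cover (f j))) (subst (λ c → S (f i -𝒪 r c)) same-coset (proj₂ (cover (f i)))))
      where
      rep : Fin m
      rep = proj₁ (cover (f j))

    bounded-multiple∈ : ∀ {m} → HasIndex S m → ∀ x → Σ ℕ λ d → 0 < d × d ≤ m × S (fromℤ (+ d) · x)
    bounded-multiple∈ index x =
      let i , j , i<j , jx-ix∈S = index-pigeonhole index (λ i → fromℤ (+ toℕ i) · x)
          j-i≡j∸i = trans (m-n≡m⊖n (toℕ j) (toℕ i)) (⊖-≥ (<⇒≤ i<j))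
      in toℕ j ∸ toℕ i , m<n⇒0<n∸m i<j , ≤-trans (m∸n≤m (toℕ j) (toℕ i)) (toℕ≤pred[n] j) ,
         subst (λ z → S (fromℤ z · x)) j-i≡j∸i (resp (fromℤ-·-sub (+ toℕ j) (+ toℕ i) x) jx-ix∈S)

lemma6p13 : (p : ℕ) → Prime p → (a b : ℤ) → IrreducibleModP p a b →
    (S : Quaternion.𝒪 p a b → Set) → Quaternion.IsOrder p a b S →
    (k : ℕ) → Quaternion.HasIndex p a b S (p ^ k) →
    Σ ℕ λ N → (N ≤ k) × Quaternion.LevelIn p a b N S
lemma6p13 p p-prime a b _ S isOrder k index = k , ≤-refl , 𝒪ₖ⊆S
  where
  open Quaternion p a b
  open QuaternionOrder p a b
  open IsOrder isOrder

  p^k·x∈S : ∀ x → S (fromℤ (pow p k) · x)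
  p^k·x∈S x =
    let d , 0<d , d≤p^k , d·x∈S = bounded-multiple∈ isOrder index x
    in bounded∈⇒pow∈ (annihilator-isAbsorbing isOrder x) p-prime {k} d {{>-nonZero 0<d}} d≤p^k d·x∈S

  𝒪ₖ⊆S : LevelIn k S
  𝒪ₖ⊆S y (t , x , y≈t+p^kx) =
    resp (≈-sym {y} {t · 1𝒪 +𝒪 fromℤ (pow p k) · x} y≈t+p^kx)
         (+-closed (·-closed t one∈) (p^k·x∈S x))
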